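{- For every integer $q\geq 2$, $C(2,q)=\lfloor q/2\rfloor\,\lceil q/2\rceil$. In particular, \[ \lim_{q\rightarrow\infty}\frac{C(2,q)}{q^2/2}=\frac12. \]
   Context: Let $F$ be a finite alphabet with $|F|=q$. Two words $u,v\in F^n$ (not necessarily distinct) are overlapping if a non-empty proper prefix of $u$ equals a non-empty proper suffix of $v$, or a non-empty proper prefix of $v$ equals a non-empty proper suffix of $u$. A code $C\subseteq F^n$ is non-overlapping if for all (not necessarily distinct) $u,v\in C$, the words $u$ and $v$ are not overlapping. $C(n,q)$ denotes the maximum cardinality of a non-overlapping code $C\subseteq F^n$ with $|F|=q$. -}

module Defs where

open import Data.Nat using (ℕ; _≤_; _<_; _∸_)
open import Data.Fin using (Fin)
open import Data.Vec using (Vec; toList)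
open import Data.List using (List; take; drop; length)
open import Data.List.Membership.Propositional using (_∈_)
open import Data.List.Relation.Unary.Unique.Propositional using (Unique)
open import Data.Product using (Σ; ∃; _×_)
open import Data.Sum using (_⊎_)
open import Relation.Nullary using (¬_)
open import Relation.Binary.PropositionalEquality using (_≡_)

Word : ℕ → ℕ → Set
Word n q = Vec (Fin q) n

PrefixSuffix : ∀ {n q} → Word n q → Word n q → Set
PrefixSuffix {n} u v =
  Σ ℕ λ k → (1 ≤ k) × (k < n) × (take k (toList u) ≡ drop (n ∸ k) (toList v))

Overlapping : ∀ {n q} → Word n q → Word n q → Set
Overlapping u v = PrefixSuffix u v ⊎ PrefixSuffix v u

-- A code is a finite set of words, represented as a duplicate-free list;
-- its cardinality is the length of the list.
Code : ℕ → ℕ → Set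
Code n q = List (Word n q)

NonOverlapping : ∀ {n q} → Code n q → Set
NonOverlapping C = ∀ u v → u ∈ C → v ∈ C → ¬ Overlapping u v

-- "C(n,q) = m": m is the maximum cardinality of a non-overlapping code in F^n.
MaxNonOverlapping : ℕ → ℕ → ℕ → Set
MaxNonOverlapping n q m =
  (Σ (Code n q) λ C → Unique C × NonOverlapping C × length C ≡ m)
  × (∀ (C : Code n q) → Unique C → NonOverlapping C → length C ≤ m)

-- A two-letter word ab can only overlap at k = 1, so words ab, cd overlap
-- exactly when a = d or c = b. Hence a code is non-overlapping iff no first
-- letter of a codeword is the last letter of a codeword: with H the set of
-- first letters, the code lies in H × (F ∖ H) and has at most |H| (q − |H|)
-- ≤ ⌊q/2⌋ ⌈q/2⌉ words. Conversely, splitting F into halves A, B of sizes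
-- ⌊q/2⌋ and ⌈q/2⌉, the code A × B attains the bound.
module Submission where

open import Defs
open import Data.Nat using (ℕ; _≤_; _*_; _+_; suc; z≤n; s≤s; ⌊_/2⌋; ⌈_/2⌉)
open import Data.Nat.Properties
  using (*-distribˡ-+; *-distribʳ-+; *-comm; *-monoˡ-≤; +-monoʳ-≤; +-comm; +-assoc; +-suc; +-cancelˡ-≡; ≤-trans; ≤-total; module ≤-Reasoning;
         n≡⌊n+n/2⌋; ⌊n/2⌋-mono; ⌊n/2⌋≤⌈n/2⌉; ⌊n/2⌋+⌈n/2⌉≡n; m≤n⇒∃[o]m+o≡n)
open import Data.Fin using (Fin; zero; suc; _↑ˡ_; _↑ʳ_; _≟_)
open import Data.Fin.Properties using (suc-injective; ↑ˡ-injective; ↑ʳ-injective)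
open import Data.Vec using (_∷_; []; head; last)
open import Data.List using (List; []; _∷_; length; map; filter; tabulate; allFin; cartesianProductWith; _++_)
open import Data.List.Properties using (length-map; length-++; length-tabulate; length-removeAt′)
open import Data.List.Membership.Propositional using (_∈_)
open import Data.List.Membership.Propositional.Properties
  using (∈-allFin; ∈-map⁺; ∈-map⁻; ∈-filter⁺; ∈-tabulate⁻; ∈-cartesianProductWith⁺; ∈-cartesianProductWith⁻)
open import Data.List.Relation.Unary.Any using (here; there; _─_; any?)
import Data.List.Relation.Unary.All as All
open import Data.List.Relation.Unary.Unique.Propositional using (Unique; _∷_)
open import Data.List.Relation.Unary.Unique.Propositional.Properties using (cartesianProductWith⁺; tabulate⁺)
open import Data.List.Relation.Binary.Subset.Propositional using (_⊆_)
open import Data.List.Relation.Binary.Disjoint.Propositional using (Disjoint)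
open import Data.Product using (Σ; _×_; _,_)
open import Data.Sum using (_⊎_; inj₁; inj₂)
import Data.Sum as Sum
open import Function using (id)
open import Function.Bundles using (_⇔_; mk⇔; Equivalence)
open import Relation.Nullary using (¬_; yes; no; contradiction)
open import Relation.Unary using (Pred; Decidable)
open import Relation.Unary.Properties using (∁?)
open import Relation.Binary.PropositionalEquality

m*[c+d]≤[m+d]*c : ∀ m c d → m ≤ c → m * (c + d) ≤ (m + d) * c
m*[c+d]≤[m+d]*c m c d m≤c = begin
  m * (c + d)   ≡⟨ *-distribˡ-+ m c d ⟩
  m * c + m * d ≤⟨ +-monoʳ-≤ (m * c) (*-monoˡ-≤ d m≤c) ⟩
  m * c + c * d ≡⟨ cong (m * c +_) (*-comm c d) ⟩
  m * c + d * c ≡⟨ *-distribʳ-+ c m d ⟨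
  (m + d) * c   ∎
  where open ≤-Reasoning

m≤n⇒m≤⌊m+n/2⌋ : ∀ {m n} → m ≤ n → m ≤ ⌊ m + n /2⌋
m≤n⇒m≤⌊m+n/2⌋ {m} {n} m≤n = subst (_≤ ⌊ m + n /2⌋) (sym (n≡⌊n+n/2⌋ m)) (⌊n/2⌋-mono (+-monoʳ-≤ m m≤n))

m≤n⇒m*n≤⌊m+n/2⌋*⌈m+n/2⌉ : ∀ {m n} → m ≤ n → m * n ≤ ⌊ m + n /2⌋ * ⌈ m + n /2⌉
m≤n⇒m*n≤⌊m+n/2⌋*⌈m+n/2⌉ {m} {n} m≤n
  with d , m+d≡⌊s/2⌋ ← m≤n⇒∃[o]m+o≡n (m≤n⇒m≤⌊m+n/2⌋ m≤n) = begin
    m * n                       ≡⟨ cong (m *_) n≡⌈s/2⌉+d ⟩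
    m * (⌈ s /2⌉ + d)           ≤⟨ m*[c+d]≤[m+d]*c m ⌈ s /2⌉ d m≤⌈s/2⌉ ⟩
    (m + d) * ⌈ s /2⌉           ≡⟨ cong (_* ⌈ s /2⌉) m+d≡⌊s/2⌋ ⟩
    ⌊ s /2⌋ * ⌈ s /2⌉           ∎
  where
  open ≤-Reasoning
  s = m + n
  m≤⌈s/2⌉ : m ≤ ⌈ s /2⌉
  m≤⌈s/2⌉ = ≤-trans (m≤n⇒m≤⌊m+n/2⌋ m≤n) (⌊n/2⌋≤⌈n/2⌉ s)
  n≡⌈s/2⌉+d : n ≡ ⌈ s /2⌉ + d
  n≡⌈s/2⌉+d = +-cancelˡ-≡ m n (⌈ s /2⌉ + d) (begin-equality
    m + n                 ≡⟨ ⌊n/2⌋+⌈n/2⌉≡n s ⟨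
    ⌊ s /2⌋ + ⌈ s /2⌉     ≡⟨ cong (_+ ⌈ s /2⌉) m+d≡⌊s/2⌋ ⟨
    m + d + ⌈ s /2⌉       ≡⟨ +-assoc m d ⌈ s /2⌉ ⟩
    m + (d + ⌈ s /2⌉)     ≡⟨ cong (m +_) (+-comm d ⌈ s /2⌉) ⟩
    m + (⌈ s /2⌉ + d)     ∎)

m+n≡q⇒m*n≤⌊q/2⌋*⌈q/2⌉ : ∀ {m n q} → m + n ≡ q → m * n ≤ ⌊ q /2⌋ * ⌈ q /2⌉
m+n≡q⇒m*n≤⌊q/2⌋*⌈q/2⌉ {m} {n} refl with ≤-total m n
... | inj₁ m≤n = m≤n⇒m*n≤⌊m+n/2⌋*⌈m+n/2⌉ m≤n
... | inj₂ n≤m rewrite *-comm m n | +-comm m n = m≤n⇒m*n≤⌊m+n/2⌋*⌈m+n/2⌉ n≤m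

module _ {A : Set} where

  ∈-─⁺ : ∀ {x y} {ys : List A} (x∈ys : x ∈ ys) → y ∈ ys → x ≢ y → y ∈ (ys ─ x∈ys)
  ∈-─⁺ (here refl) (here refl)  x≢y = contradiction refl x≢y
  ∈-─⁺ (here refl) (there y∈ys) x≢y = y∈ys
  ∈-─⁺ (there x∈ys) (here refl)  x≢y = here refl
  ∈-─⁺ (there x∈ys) (there y∈ys) x≢y = there (∈-─⁺ x∈ys y∈ys x≢y)

  Unique∧⊆⇒length≤ : ∀ {xs ys : List A} → Unique xs → xs ⊆ ys → length xs ≤ length ys
  Unique∧⊆⇒length≤ {[]}     _               _     = z≤n
  Unique∧⊆⇒length≤ {x ∷ xs} {ys} (x∉xs ∷ uxs) x∷xs⊆ys = begin
    suc (length xs)              ≤⟨ s≤s (Unique∧⊆⇒length≤ uxs xs⊆ys─x) ⟩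
    suc (length (ys ─ x∈ys))     ≡⟨ length-removeAt′ ys _ ⟨
    length ys                    ∎
    where
    open ≤-Reasoning
    x∈ys = x∷xs⊆ys (here refl)
    xs⊆ys─x : xs ⊆ (ys ─ x∈ys)
    xs⊆ys─x y∈xs = ∈-─⁺ x∈ys (x∷xs⊆ys (there y∈xs)) (All.lookup x∉xs y∈xs)

  length-filter+length-filter-∁ : ∀ {p} {P : Pred A p} (P? : Decidable P) xs →
    length (filter P? xs) + length (filter (∁? P?) xs) ≡ length xs
  length-filter+length-filter-∁ P? []       = refl
  length-filter+length-filter-∁ P? (x ∷ xs) with P? x
  ... | yes _ = cong suc (length-filter+length-filter-∁ P? xs)
  ... | no _  = trans (+-suc _ _) (cong suc (length-filter+length-filter-∁ P? xs))

length-cartesianProductWith : ∀ {A B C : Set} (f : A → B → C) xs ys →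
  length (cartesianProductWith f xs ys) ≡ length xs * length ys
length-cartesianProductWith f []       ys = refl
length-cartesianProductWith f (x ∷ xs) ys = begin
  length (map (f x) ys ++ cartesianProductWith f xs ys)        ≡⟨ length-++ (map (f x) ys) ⟩
  length (map (f x) ys) + length (cartesianProductWith f xs ys) ≡⟨ cong₂ _+_ (length-map (f x) ys) (length-cartesianProductWith f xs ys) ⟩
  length ys + length xs * length ys                              ∎
  where open ≡-Reasoning

module _ {q : ℕ} where

  prefixSuffix₂⇔head≡last : (u v : Word 2 q) → PrefixSuffix u v ⇔ head u ≡ last v
  prefixSuffix₂⇔head≡last (a ∷ b ∷ []) (c ∷ d ∷ []) = mk⇔ to from
    where
    to : PrefixSuffix (a ∷ b ∷ []) (c ∷ d ∷ []) → a ≡ d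
    to (1 , _ , _ , refl) = refl
    to (suc (suc _) , _ , s≤s (s≤s ()) , _)
    from : a ≡ d → PrefixSuffix (a ∷ b ∷ []) (c ∷ d ∷ [])
    from a≡d = 1 , s≤s z≤n , s≤s (s≤s z≤n) , cong (_∷ []) a≡d

  overlapping₂⇔ : (u v : Word 2 q) → Overlapping u v ⇔ (head u ≡ last v ⊎ head v ≡ last u)
  overlapping₂⇔ u v = mk⇔
    (Sum.map (Equivalence.to (prefixSuffix₂⇔head≡last u v)) (Equivalence.to (prefixSuffix₂⇔head≡last v u)))
    (Sum.map (Equivalence.from (prefixSuffix₂⇔head≡last u v)) (Equivalence.from (prefixSuffix₂⇔head≡last v u)))

  pairs : List (Fin q) → List (Fin q) → Code 2 q
  pairs = cartesianProductWith (λ a b → a ∷ b ∷ [])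

  pairs-unique : ∀ {A B} → Unique A → Unique B → Unique (pairs A B)
  pairs-unique = cartesianProductWith⁺ _ λ { refl → refl , refl }

  pairs-nonOverlapping : ∀ {A B} → Disjoint A B → NonOverlapping (pairs A B)
  pairs-nonOverlapping {A} {B} A#B u v u∈ v∈ u≈v
    with a , b , a∈A , b∈B , refl ← ∈-cartesianProductWith⁻ _ A B u∈
       | c , d , c∈A , d∈B , refl ← ∈-cartesianProductWith⁻ _ A B v∈
    with Equivalence.to (overlapping₂⇔ u v) u≈v
  ... | inj₁ refl = A#B (a∈A , d∈B)
  ... | inj₂ refl = A#B (c∈A , b∈B)

  length-pairs : ∀ A B → length (pairs A B) ≡ length A * length B
  length-pairs = length-cartesianProductWith _

  IsFirstLetter : Code 2 q → Fin q → Set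
  IsFirstLetter C a = a ∈ map head C

  isFirstLetter? : ∀ C → Decidable (IsFirstLetter C)
  isFirstLetter? C a = any? (a ≟_) (map head C)

  nonOverlapping⇒⊆pairs : ∀ {C} → NonOverlapping C →
    C ⊆ pairs (filter (isFirstLetter? C) (allFin q)) (filter (∁? (isFirstLetter? C)) (allFin q))
  nonOverlapping⇒⊆pairs {C} noC {u@(a ∷ b ∷ [])} u∈C =
    ∈-cartesianProductWith⁺ _ (∈-filter⁺ _ (∈-allFin a) (∈-map⁺ head u∈C)) (∈-filter⁺ _ (∈-allFin b) b∉firsts)
    where
    b∉firsts : ¬ IsFirstLetter C b
    b∉firsts b∈firsts with v , v∈C , refl ← ∈-map⁻ head b∈firsts =
      noC u v u∈C v∈C (Equivalence.from (overlapping₂⇔ u v) (inj₂ refl))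

  nonOverlapping⇒length≤⌊q/2⌋*⌈q/2⌉ : ∀ {C} → Unique C → NonOverlapping C → length C ≤ ⌊ q /2⌋ * ⌈ q /2⌉
  nonOverlapping⇒length≤⌊q/2⌋*⌈q/2⌉ {C} uniqueC noC = begin
    length C                          ≤⟨ Unique∧⊆⇒length≤ uniqueC (nonOverlapping⇒⊆pairs noC) ⟩
    length (pairs firsts others)      ≡⟨ length-pairs firsts others ⟩
    length firsts * length others     ≤⟨ m+n≡q⇒m*n≤⌊q/2⌋*⌈q/2⌉ {length firsts} |firsts|+|others|≡q ⟩
    ⌊ q /2⌋ * ⌈ q /2⌉                 ∎
    where
    open ≤-Reasoning
    firsts = filter (isFirstLetter? C) (allFin q)
    others = filter (∁? (isFirstLetter? C)) (allFin q)
    |firsts|+|others|≡q : length firsts + length others ≡ q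
    |firsts|+|others|≡q = trans (length-filter+length-filter-∁ (isFirstLetter? C) (allFin q)) (length-tabulate id)

HasNonOverlappingCode : ℕ → ℕ → ℕ → Set
HasNonOverlappingCode n q m = Σ (Code n q) λ C → Unique C × NonOverlapping C × length C ≡ m

↑ˡ≢↑ʳ : ∀ {m n} (i : Fin m) (j : Fin n) → i ↑ˡ n ≢ m ↑ʳ j
↑ˡ≢↑ʳ zero    j ()
↑ˡ≢↑ʳ (suc i) j eq = ↑ˡ≢↑ʳ i j (suc-injective eq)

splitAlphabetCode : ∀ m n → HasNonOverlappingCode 2 (m + n) (m * n)
splitAlphabetCode m n =
  pairs left right ,
  pairs-unique (tabulate⁺ (↑ˡ-injective n _ _)) (tabulate⁺ (↑ʳ-injective m _ _)) ,
  pairs-nonOverlapping left#right ,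
  trans (length-pairs left right) (cong₂ _*_ |left|≡m |right|≡n)
  where
  left right : List (Fin (m + n))
  left  = tabulate (_↑ˡ n)
  right = tabulate (m ↑ʳ_)
  |left|≡m : length left ≡ m
  |left|≡m = length-tabulate (_↑ˡ n)
  |right|≡n : length right ≡ n
  |right|≡n = length-tabulate (m ↑ʳ_)
  left#right : Disjoint left right
  left#right (x∈left , x∈right)
    with i , refl ← ∈-tabulate⁻ x∈left | j , eq ← ∈-tabulate⁻ x∈right = ↑ˡ≢↑ʳ i j eq

theorem6 : ∀ (q : ℕ) → 2 ≤ q → MaxNonOverlapping 2 q (⌊ q /2⌋ * ⌈ q /2⌉)
theorem6 q _ =
  subst (λ r → HasNonOverlappingCode 2 r (⌊ q /2⌋ * ⌈ q /2⌉)) (⌊n/2⌋+⌈n/2⌉≡n q) (splitAlphabetCode ⌊ q /2⌋ ⌈ q /2⌉) ,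
  λ C → nonOverlapping⇒length≤⌊q/2⌋*⌈q/2⌉ {C = C}
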